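{- Let $d$ be a positive integer and let $\{c(k)\}_{k=0}^\infty$ be a sequence of complex numbers. (a) If $c(k)=0$ for all integers $k$ with $\frac{d-1}{2}<k\le d-1$, then \[ \Big(\sum_{j=0}^{d-1} c(j)\Big)^2=\sum_{k=0}^{d-1}\sum_{j=0}^{k} c(j)\,c(k-j). \] (b) If, in addition to the hypothesis of (a), $c(ld)\neq 0$ and $\frac{c(ld+k)}{c(ld)}=c(k)$ for all nonnegative integers $l$ and $k$ with $0\le k\le d-1$, then for all nonnegative integers $l$ and $k$ with $0\le k\le d-1$, \[ \sum_{j=0}^{ld+k} c(j)\,c(ld+k-j)=\sum_{i=0}^{l} c(id)\,c\big((l-i)d\big)\sum_{j=0}^{k} c(j)\,c(k-j). \] -}

module Defs where

open import Level using (Level; _⊔_) renaming (suc to lsuc)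
open import Data.Nat using (ℕ) renaming (zero to ℕzero; suc to ℕsuc)
open import Algebra.Bundles using (CommutativeRing)
open import Relation.Nullary using (¬_)

-- A field: a commutative ring with 0 ≠ 1 and a (total) inverse map
-- which is a multiplicative inverse on every nonzero element.
-- (ℂ is an instance; agda-stdlib has no complex numbers.)
record Field (c ℓ : Level) : Set (lsuc (c ⊔ ℓ)) where
  field
    commutativeRing : CommutativeRing c ℓ
  open CommutativeRing commutativeRing public
  field
    _⁻¹     : Carrier → Carrier
    0≉1     : ¬ (0# ≈ 1#)
    ⁻¹-inverseʳ : ∀ x → ¬ (x ≈ 0#) → (x * (x ⁻¹)) ≈ 1#

  infixl 7 _/_
  _/_ : Carrier → Carrier → Carrier
  x / y = x * (y ⁻¹)

  sumTo : ℕ → (ℕ → Carrier) → Carrier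
  sumTo ℕzero    f = f ℕzero
  sumTo (ℕsuc n) f = sumTo n f + f (ℕsuc n)

open Field ⦃ ... ⦄ public
  using (Carrier; _≈_; 0#; sumTo; _/_) renaming (_*_ to _·_)

{-# OPTIONS --safe #-}
-- The hypothesis of (a) kills every product c x · c y with x, y ≤ d - 1 and
-- x + y ≥ d, since then one of x, y exceeds (d - 1)/2.  Hence the square of the
-- partial sum only sees the pairs with x + y ≤ d - 1, which is (a).  Under (b),
-- c (l d + r) = c (l d) c r for r < d, so splitting j = i d + r in the
-- convolution at l d + k factors every block as c (i d) c ((l - i) d) times the
-- convolution at k; the terms with r > k pair up as above and vanish.
module Submission where

open import Defs using (Field)
open import Algebra.Bundles using (Semiring)
import Algebra.Properties.CommutativeSemigroup as CommutativeSemigroupProperties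
open import Data.Nat using (ℕ; zero; suc; _+_; _*_; _∸_; _≤_; _<_; _≤′_; ≤′-refl; ≤′-step; s≤s)
open import Data.Nat.Properties
  using ( ≤-refl; ≤-reflexive; ≤-trans; n<1+n; m<n⇒m<1+n; ≤-total; <⇒≤; ≤-pred; <-≤-trans; ≤⇒≤′; ≤′⇒≤; m<n⇒0<n∸m
        ; +-suc; +-mono-≤; +-monoʳ-≤; m≤m+n
        ; n∸n≡0; m∸n≤m; m+n∸n≡m; m+[n∸m]≡n; m≤n+m∸n; +-∸-assoc; ∸-monoʳ-≤
        ; [m+n]∸[m+o]≡n∸o )
open import Data.Product using (_×_; _,_)
open import Data.Sum using (_⊎_; inj₁; inj₂)
open import Relation.Nullary using (¬_)
open import Relation.Binary.PropositionalEquality as ≡ using (_≡_; cong)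
import Relation.Binary.Reasoning.Setoid as SetoidReasoning
import Data.Nat.Properties as ℕ

m<n+o⇒m<2*n⊎m<2*o : ∀ {m n o} → m < n + o → m < 2 * n ⊎ m < 2 * o
m<n+o⇒m<2*n⊎m<2*o {n = n} {o} m<n+o with ≤-total n o
... | inj₁ n≤o = inj₂ (<-≤-trans m<n+o (+-mono-≤ n≤o (m≤m+n o 0)))
... | inj₂ o≤n = inj₁ (<-≤-trans m<n+o (+-monoʳ-≤ n (≤-trans o≤n (m≤m+n n 0))))

[m*o+p]∸[n*o+q]≡[m∸n]*o+p∸q : ∀ {m n} o p q → n ≤ m →
                                m * o + p ∸ (n * o + q) ≡ (m ∸ n) * o + p ∸ q
[m*o+p]∸[n*o+q]≡[m∸n]*o+p∸q {m} {n} o p q n≤m = begin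
  m * o + p ∸ (n * o + q)                   ≡⟨ cong (λ x → x * o + p ∸ (n * o + q)) (≡.sym (m+[n∸m]≡n n≤m)) ⟩
  (n + (m ∸ n)) * o + p ∸ (n * o + q)       ≡⟨ cong (λ x → x + p ∸ (n * o + q)) (ℕ.*-distribʳ-+ o n (m ∸ n)) ⟩
  n * o + (m ∸ n) * o + p ∸ (n * o + q)     ≡⟨ cong (_∸ (n * o + q)) (ℕ.+-assoc (n * o) ((m ∸ n) * o) p) ⟩
  n * o + ((m ∸ n) * o + p) ∸ (n * o + q)   ≡⟨ [m+n]∸[m+o]≡n∸o (n * o) ((m ∸ n) * o + p) q ⟩
  (m ∸ n) * o + p ∸ q                       ∎
  where open ≡.≡-Reasoning

[1+m]*n+p∸q≡m*n+[n+p∸q] : ∀ m n p {q} → q ≤ n + p → suc m * n + p ∸ q ≡ m * n + (n + p ∸ q)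
[1+m]*n+p∸q≡m*n+[n+p∸q] m n p {q} q≤n+p = ≡.trans
  (cong (_∸ q) (≡.trans (cong (_+ p) (ℕ.+-comm n (m * n))) (ℕ.+-assoc (m * n) n p)))
  (+-∸-assoc (m * n) q≤n+p)

module NatIndexedSums {c ℓ} (R : Semiring c ℓ) where
  open Semiring R renaming (_+_ to _⊕_; _*_ to _·_)
  open SetoidReasoning setoid

  ∑< : ℕ → (ℕ → Carrier) → Carrier
  ∑< zero    f = 0#
  ∑< (suc n) f = ∑< n f ⊕ f n

  ∑<-cong : ∀ n {f g} → (∀ i → i < n → f i ≈ g i) → ∑< n f ≈ ∑< n g
  ∑<-cong zero    f≈g = refl
  ∑<-cong (suc n) f≈g = +-cong (∑<-cong n (λ i i<n → f≈g i (m<n⇒m<1+n i<n))) (f≈g n (n<1+n n))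

  ∑<-distrib-+ : ∀ n f g → ∑< n (λ i → f i ⊕ g i) ≈ ∑< n f ⊕ ∑< n g
  ∑<-distrib-+ zero    f g = sym (+-identityʳ 0#)
  ∑<-distrib-+ (suc n) f g = begin
    ∑< n (λ i → f i ⊕ g i) ⊕ (f n ⊕ g n) ≈⟨ +-congʳ (∑<-distrib-+ n f g) ⟩
    (∑< n f ⊕ ∑< n g) ⊕ (f n ⊕ g n)      ≈⟨ +-interchange _ _ _ _ ⟩
    (∑< n f ⊕ f n) ⊕ (∑< n g ⊕ g n)      ∎
    where open CommutativeSemigroupProperties +-commutativeSemigroup
            using () renaming (interchange to +-interchange)

  *-distribˡ-∑< : ∀ n x f → x · ∑< n f ≈ ∑< n (λ i → x · f i)
  *-distribˡ-∑< zero    x f = zeroʳ x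
  *-distribˡ-∑< (suc n) x f = trans (distribˡ x (∑< n f) (f n)) (+-congʳ (*-distribˡ-∑< n x f))

  *-distribʳ-∑< : ∀ n f x → ∑< n f · x ≈ ∑< n (λ i → f i · x)
  *-distribʳ-∑< zero    f x = zeroˡ x
  *-distribʳ-∑< (suc n) f x = trans (distribʳ x (∑< n f) (f n)) (+-congʳ (*-distribʳ-∑< n f x))

  ∑<-split : ∀ m n f → ∑< (m + n) f ≈ ∑< m f ⊕ ∑< n (λ j → f (m + j))
  ∑<-split m zero    f = trans (reflexive (cong (λ k → ∑< k f) (ℕ.+-identityʳ m))) (sym (+-identityʳ _))
  ∑<-split m (suc n) f = begin
    ∑< (m + suc n) f                            ≡⟨ cong (λ k → ∑< k f) (+-suc m n) ⟩
    ∑< (m + n) f ⊕ f (m + n)                    ≈⟨ +-congʳ (∑<-split m n f) ⟩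
    (∑< m f ⊕ ∑< n (λ j → f (m + j))) ⊕ f (m + n) ≈⟨ +-assoc _ _ _ ⟩
    ∑< m f ⊕ (∑< n (λ j → f (m + j)) ⊕ f (m + n)) ∎

  ∑<-blocks : ∀ l d f → ∑< (l * d) f ≈ ∑< l (λ i → ∑< d (λ r → f (i * d + r)))
  ∑<-blocks zero    d f = refl
  ∑<-blocks (suc l) d f = begin
    ∑< (suc l * d) f                                      ≡⟨ cong (λ k → ∑< k f) (ℕ.+-comm d (l * d)) ⟩
    ∑< (l * d + d) f                                      ≈⟨ ∑<-split (l * d) d f ⟩
    ∑< (l * d) f ⊕ ∑< d (λ r → f (l * d + r))             ≈⟨ +-congʳ (∑<-blocks l d f) ⟩
    ∑< l (λ i → ∑< d (λ r → f (i * d + r))) ⊕ ∑< d (λ r → f (l * d + r)) ∎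

  ∑<-vanishing-tail : ∀ {m n f} → m ≤ n → (∀ j → m ≤ j → j < n → f j ≈ 0#) → ∑< n f ≈ ∑< m f
  ∑<-vanishing-tail {f = f} m≤n = drop (≤⇒≤′ m≤n)
    where
    drop : ∀ {m n} → m ≤′ n → (∀ j → m ≤ j → j < n → f j ≈ 0#) → ∑< n f ≈ ∑< m f
    drop ≤′-refl _ = refl
    drop {m} (≤′-step {n} m≤′n) f≈0 = begin
      ∑< n f ⊕ f n  ≈⟨ +-congˡ (f≈0 n (≤′⇒≤ m≤′n) (n<1+n n)) ⟩
      ∑< n f ⊕ 0#   ≈⟨ +-identityʳ _ ⟩
      ∑< n f        ≈⟨ drop m≤′n (λ j m≤j j<n → f≈0 j m≤j (m<n⇒m<1+n j<n)) ⟩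
      ∑< m f        ∎

  ∑<-antidiagonal : ∀ n (g : ℕ → ℕ → Carrier) →
                    ∑< n (λ k → ∑< (suc k) (λ j → g j (k ∸ j))) ≈ ∑< n (λ i → ∑< (n ∸ i) (g i))
  ∑<-antidiagonal zero    g = refl
  -- The antidiagonal k = n contributes exactly one new entry, g i (n ∸ i), to each row i ≤ n.
  ∑<-antidiagonal (suc n) g = begin
    ∑< n (λ k → ∑< (suc k) (λ j → g j (k ∸ j))) ⊕ ∑< (suc n) (λ j → g j (n ∸ j))
      ≈⟨ +-congʳ (∑<-antidiagonal n g) ⟩
    ∑< n (λ i → ∑< (n ∸ i) (g i)) ⊕ ∑< (suc n) (λ j → g j (n ∸ j))
      ≈⟨ +-congʳ (sym last-row-empty) ⟩
    ∑< (suc n) (λ i → ∑< (n ∸ i) (g i)) ⊕ ∑< (suc n) (λ j → g j (n ∸ j))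
      ≈⟨ sym (∑<-distrib-+ (suc n) _ _) ⟩
    ∑< (suc n) (λ i → ∑< (n ∸ i) (g i) ⊕ g i (n ∸ i))
      ≈⟨ ∑<-cong (suc n) (λ i i<1+n → reflexive (cong (λ k → ∑< k (g i)) (≡.sym (+-∸-assoc 1 (≤-pred i<1+n))))) ⟩
    ∑< (suc n) (λ i → ∑< (suc n ∸ i) (g i)) ∎
    where
    last-row-empty : ∑< (suc n) (λ i → ∑< (n ∸ i) (g i)) ≈ ∑< n (λ i → ∑< (n ∸ i) (g i))
    last-row-empty = trans (+-congˡ (reflexive (cong (λ k → ∑< k (g n)) (n∸n≡0 n)))) (+-identityʳ _)

module Convolution {a ℓ} (F : Field a ℓ) (D : ℕ) (c : ℕ → Field.Carrier F)
       (c-vanishes : ∀ k → D < 2 * k → k ≤ D → Field._≈_ F (c k) (Field.0# F)) where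
  open Field F renaming (_+_ to _⊕_; _*_ to _·_)
  open NatIndexedSums semiring
  open CommutativeSemigroupProperties *-commutativeSemigroup using (interchange; x∙yz≈y∙xz)
  open SetoidReasoning setoid

  _⋆_ : (ℕ → Carrier) → (ℕ → Carrier) → ℕ → Carrier
  (f ⋆ g) n = sumTo n (λ j → f j · g (n ∸ j))

  sumTo≈∑< : ∀ n f → sumTo n f ≈ ∑< (suc n) f
  sumTo≈∑< zero    f = sym (+-identityˡ _)
  sumTo≈∑< (suc n) f = +-congʳ (sumTo≈∑< n f)

  product-vanishes : ∀ {x y} → x ≤ D → y ≤ D → D < x + y → c x · c y ≈ 0#
  product-vanishes {x} {y} x≤D y≤D D<x+y with m<n+o⇒m<2*n⊎m<2*o {n = x} {y} D<x+y
  ... | inj₁ D<2x = trans (*-congʳ (c-vanishes x D<2x x≤D)) (zeroˡ _)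
  ... | inj₂ D<2y = trans (*-congˡ (c-vanishes y D<2y y≤D)) (zeroʳ _)

  square-of-sum : sumTo D c · sumTo D c ≈ sumTo D (c ⋆ c)
  square-of-sum = begin
    sumTo D c · sumTo D c                                ≈⟨ *-cong (sumTo≈∑< D c) (sumTo≈∑< D c) ⟩
    ∑< N c · ∑< N c                                      ≈⟨ *-distribʳ-∑< N c (∑< N c) ⟩
    ∑< N (λ i → c i · ∑< N c)                            ≈⟨ ∑<-cong N (λ i _ → *-distribˡ-∑< N (c i) c) ⟩
    ∑< N (λ i → ∑< N (λ j → c i · c j))                  ≈⟨ ∑<-cong N below-antidiagonal ⟩
    ∑< N (λ i → ∑< (N ∸ i) (λ j → c i · c j))            ≈⟨ sym (∑<-antidiagonal N (λ i j → c i · c j)) ⟩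
    ∑< N (λ k → ∑< (suc k) (λ j → c j · c (k ∸ j)))      ≈⟨ ∑<-cong N (λ k _ → sym (sumTo≈∑< k _)) ⟩
    ∑< N (c ⋆ c)                                         ≈⟨ sym (sumTo≈∑< D (c ⋆ c)) ⟩
    sumTo D (c ⋆ c)                                      ∎
    where
    N = suc D
    below-antidiagonal : ∀ i → i < N → ∑< N (λ j → c i · c j) ≈ ∑< (N ∸ i) (λ j → c i · c j)
    below-antidiagonal i i<N = ∑<-vanishing-tail (m∸n≤m N i) λ j N∸i≤j j<N →
      product-vanishes (≤-pred i<N) (≤-pred j<N) (≤-trans (m≤n+m∸n N i) (+-monoʳ-≤ i N∸i≤j))

  module Multiplicative
      (c-nonzero : ∀ l → ¬ (c (l * suc D) ≈ 0#))
      (c-ratio : ∀ l k → k ≤ D → (c (l * suc D + k) / c (l * suc D)) ≈ c k)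
      where
    d : ℕ
    d = suc D

    c-mult : ∀ l {k} → k ≤ D → c (l * d + k) ≈ c (l * d) · c k
    c-mult l {k} k≤D = begin
      y               ≈⟨ sym (*-identityʳ y) ⟩
      y · 1#          ≈⟨ *-congˡ (sym (⁻¹-inverseʳ x (c-nonzero l))) ⟩
      y · (x · x ⁻¹)  ≈⟨ x∙yz≈y∙xz y x (x ⁻¹) ⟩
      x · (y · x ⁻¹)  ≈⟨ *-congˡ (c-ratio l k k≤D) ⟩
      x · c k         ∎
      where
      x = c (l * d)
      y = c (l * d + k)

    c-mult² : ∀ i n {r s} → r ≤ D → s ≤ D →
              c (i * d + r) · c (n * d + s) ≈ (c (i * d) · c (n * d)) · (c r · c s)
    c-mult² i n r≤D s≤D = trans (*-cong (c-mult i r≤D) (c-mult n s≤D)) (interchange _ _ _ _)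

    head-block : ∀ {k} → k ≤ D → ∀ i n →
                 ∑< (suc k) (λ r → c (i * d + r) · c (n * d + k ∸ r)) ≈ (c (i * d) · c (n * d)) · (c ⋆ c) k
    head-block {k} k≤D i n = begin
      ∑< (suc k) (λ r → c (i * d + r) · c (n * d + k ∸ r)) ≈⟨ ∑<-cong (suc k) factor ⟩
      ∑< (suc k) (λ r → A · (c r · c (k ∸ r)))             ≈⟨ sym (*-distribˡ-∑< (suc k) A _) ⟩
      A · ∑< (suc k) (λ r → c r · c (k ∸ r))               ≈⟨ *-congˡ (sym (sumTo≈∑< k _)) ⟩
      A · (c ⋆ c) k                                        ∎
      where
      A = c (i * d) · c (n * d)
      factor : ∀ r → r < suc k → c (i * d + r) · c (n * d + k ∸ r) ≈ A · (c r · c (k ∸ r))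
      factor r r<1+k = trans (*-congˡ (reflexive (cong c (+-∸-assoc (n * d) r≤k))))
                             (c-mult² i n (≤-trans r≤k k≤D) (≤-trans (m∸n≤m k r) k≤D))
        where r≤k = ≤-pred r<1+k

    full-block : ∀ {k} → k ≤ D → ∀ i {n} → 0 < n →
                 ∑< d (λ r → c (i * d + r) · c (n * d + k ∸ r)) ≈ (c (i * d) · c (n * d)) · (c ⋆ c) k
    full-block {k} k≤D i {suc m} _ = trans (∑<-vanishing-tail (s≤s k≤D) beyond-k) (head-block k≤D i (suc m))
      where
      beyond-k : ∀ r → k < r → r < d → c (i * d + r) · c (suc m * d + k ∸ r) ≈ 0#
      beyond-k r k<r r<d = begin
        c (i * d + r) · c (suc m * d + k ∸ r)            ≡⟨ cong (λ x → c (i * d + r) · c x) (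
                                                             [1+m]*n+p∸q≡m*n+[n+p∸q] m d k r≤d+k) ⟩
        c (i * d + r) · c (m * d + s)                    ≈⟨ c-mult² i m r≤D s≤D ⟩
        (c (i * d) · c (m * d)) · (c r · c s)            ≈⟨ *-congˡ (product-vanishes r≤D s≤D D<r+s) ⟩
        (c (i * d) · c (m * d)) · 0#                     ≈⟨ zeroʳ _ ⟩
        0#                                               ∎
        where
        s = d + k ∸ r
        r≤D = ≤-pred r<d
        r≤d+k = ≤-trans (<⇒≤ r<d) (m≤m+n d k)
        s≤D : s ≤ D
        s≤D = ≤-trans (∸-monoʳ-≤ (d + k) k<r) (≤-reflexive (m+n∸n≡m D k))
        D<r+s : D < r + s
        D<r+s = ≤-trans (s≤s (m≤m+n D k)) (≤-reflexive (≡.sym (m+[n∸m]≡n r≤d+k)))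

    convolution-at-multiple : ∀ {k} → k ≤ D → ∀ l →
      (c ⋆ c) (l * d + k) ≈ sumTo l (λ i → c (i * d) · c ((l ∸ i) * d)) · (c ⋆ c) k
    convolution-at-multiple {k} k≤D l = begin
      (c ⋆ c) (l * d + k)                                ≈⟨ sumTo≈∑< (l * d + k) f ⟩
      ∑< (suc (l * d + k)) f                             ≡⟨ cong (λ n → ∑< n f) (≡.sym (+-suc (l * d) k)) ⟩
      ∑< (l * d + suc k) f                               ≈⟨ ∑<-split (l * d) (suc k) f ⟩
      ∑< (l * d) f ⊕ ∑< (suc k) (λ r → f (l * d + r))    ≈⟨ +-congʳ (∑<-blocks l d f) ⟩
      ∑< l (λ i → ∑< d (λ r → f (i * d + r))) ⊕ ∑< (suc k) (λ r → f (l * d + r))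
                                                         ≈⟨ +-cong (∑<-cong l earlier-block) last-block ⟩
      ∑< l (λ i → A i · (c ⋆ c) k) ⊕ A l · (c ⋆ c) k     ≈⟨ sym (*-distribʳ-∑< (suc l) A ((c ⋆ c) k)) ⟩
      ∑< (suc l) A · (c ⋆ c) k                           ≈⟨ *-congʳ (sym (sumTo≈∑< l A)) ⟩
      sumTo l A · (c ⋆ c) k                              ∎
      where
      f = λ j → c j · c (l * d + k ∸ j)
      A = λ i → c (i * d) · c ((l ∸ i) * d)
      shift : ∀ {i} → i ≤ l → ∀ r → f (i * d + r) ≈ c (i * d + r) · c ((l ∸ i) * d + k ∸ r)
      shift i≤l r = *-congˡ (reflexive (cong c ([m*o+p]∸[n*o+q]≡[m∸n]*o+p∸q d k r i≤l)))
      earlier-block : ∀ i → i < l → ∑< d (λ r → f (i * d + r)) ≈ A i · (c ⋆ c) k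
      earlier-block i i<l = trans (∑<-cong d (λ r _ → shift (<⇒≤ i<l) r)) (full-block k≤D i (m<n⇒0<n∸m i<l))
      last-block : ∑< (suc k) (λ r → f (l * d + r)) ≈ A l · (c ⋆ c) k
      last-block = trans (∑<-cong (suc k) (λ r _ → shift ≤-refl r)) (head-block k≤D l (l ∸ l))

open Defs using (Carrier; _≈_; 0#; sumTo; _/_; _·_)

lemma1 : ∀ {a ℓ} ⦃ F : Field a ℓ ⦄ →
    (d : ℕ) → 0 < d → (c : ℕ → Carrier) →
    (∀ k → d ∸ 1 < 2 * k → k ≤ d ∸ 1 → c k ≈ 0#) →
    ((sumTo (d ∸ 1) c) · (sumTo (d ∸ 1) c)
        ≈ sumTo (d ∸ 1) (λ k → sumTo k (λ j → c j · c (k ∸ j))))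
    ×
    ((∀ l → ¬ (c (l * d) ≈ 0#)) →
     (∀ l k → k ≤ d ∸ 1 → (c (l * d + k) / c (l * d)) ≈ c k) →
     ∀ l k → k ≤ d ∸ 1 →
       sumTo (l * d + k) (λ j → c j · c (l * d + k ∸ j))
         ≈ (sumTo l (λ i → c (i * d) · c ((l ∸ i) * d))
             · sumTo k (λ j → c j · c (k ∸ j))))
lemma1 ⦃ F ⦄ (suc D) _ c c-vanishes =
  square-of-sum , λ c-nonzero c-ratio l k k≤D → convolution-at-multiple c-nonzero c-ratio k≤D l
  where
  open Convolution F D c c-vanishes
  open Multiplicative
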